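{- Let $d\ge1$ and let $f\in\mathbb{F}_{\bar{A},\bar{C}}[x_1,\ldots,x_n]$ be a homogeneous polynomial of degree $d'$ with $1\le d'\le d$. Then the $(1,d'+1,1)$-th entry of $\Phi(f)\in\mathbb{A}'_d$ is equal to $\phi(f_{d'})$, where $f_{d'}$ is the homogeneous degree-$d'$ component of $f$.
   Context: $\mathbb{F}_{\bar{A},\bar{C}}[X]$ is the noncommutative, nonassociative polynomial algebra: basis the monomial $1$ and rooted full binary trees with designated left/right children whose leaves are labeled by variables from $X$; the product of $m_1,m_2$ is the tree with left subtree $m_1$ and right subtree $m_2$; degree = number of leaves. $Z=\{z_{i,j,k}:i\in[n],j,k\in[d]\}$ are commuting variables. $\mathbb{A}'_d=\mathbb{F}(Z)^{d(d+1)^2}$ with entries indexed $x[i,j,k]$, $1\le i,j\le d+1$, $1\le k\le d$, and product $z=x\circ y$ with $z[i,j,d]=0$, $z[i,j,k]=\sum_{l=1}^{d+1}x[i,l,k+1]y[l,j,k+1]$ for $1\le k\le d-1$. $Z_i\in\mathbb{A}'_d$ has $(j,j+1,k)$-th entry $z_{i,j,k}$ for $j,k\in[d]$ and other entries $0$. $\Phi$ is the linear map sending each monomial of degree $\ge1$ to its evaluation at $x_i\mapsto Z_i$ (left child times right child using $\circ$). For a monomial $m$ of degree $d'$, $\sigma_m(t)$ is the index of the variable labeling the $t$-th leaf in left-to-right order and $l^m_t$ the level of that leaf (level of a node $=1+$ distance from the root). $\phi(m)=\prod_{t=1}^{d'}z_{\sigma_m(t),t,l^m_t}$, extended linearly to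 $\phi:\mathbb{F}_{\bar{A},\bar{C}}[X]\to\mathbb{F}[Z]$. -}

module Defs where

open import Level using (Level)
open import Algebra.Bundles using (CommutativeRing)
open import Data.Nat using (ℕ; zero; suc; _≟_)
open import Data.Nat using () renaming (_+_ to _+ℕ_)
open import Data.Fin using (Fin; toℕ)
open import Data.Maybe using (Maybe; just; nothing)
import Data.Maybe
open import Data.Fin.Properties using () renaming (_≟_ to _≟ᶠ_)
open import Data.List using (List; []; _∷_; _++_; filter)
open import Data.List.Relation.Unary.All using (All)
open import Data.Product using (_×_; _,_; proj₁; proj₂)
open import Relation.Nullary using (yes; no)
open import Relation.Binary.PropositionalEquality using (_≡_)

-- Nonassociative noncommutative monomials in variables x_1..x_n
-- (variables indexed by Fin n, i.e. x_{i+1} ↔ i).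

data Tree (n : ℕ) : Set where
  leaf : Fin n → Tree n
  node : Tree n → Tree n → Tree n

data Mon (n : ℕ) : Set where
  𝟙  : Mon n
  tm : Tree n → Mon n

degT : ∀ {n} → Tree n → ℕ
degT (leaf _)   = 1
degT (node a b) = degT a +ℕ degT b

deg : ∀ {n} → Mon n → ℕ
deg 𝟙      = 0
deg (tm t) = degT t

nextFin : ∀ {d} → Fin d → Maybe (Fin d)
nextFin {suc zero}    Fin.zero    = nothing
nextFin {suc (suc d)} Fin.zero    = just (Fin.suc Fin.zero)
nextFin {suc (suc d)} (Fin.suc k) = Data.Maybe.map Fin.suc (nextFin k)

leavesL : ∀ {n} → Tree n → ℕ → List (Fin n × ℕ)
leavesL (leaf i)   l = (i , l) ∷ []
leavesL (node a b) l = leavesL a (suc l) ++ leavesL b (suc l)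

module WithRing {c ℓ : Level} (R : CommutativeRing c ℓ) where
  open CommutativeRing R

  -- Polynomials in F_{Ā,C̄}[x_1..x_n] as formal finite linear combinations
  -- Σ c_k m_k, represented as lists of (coefficient, monomial).
  Poly : ℕ → Set c
  Poly n = List (Carrier × Mon n)

  Homogeneous : ∀ {n} → ℕ → Poly n → Set c
  Homogeneous e f = All (λ p → deg (proj₂ p) ≡ e) f

  component : ∀ {n} → ℕ → Poly n → Poly n
  component e f = filter (λ p → deg (proj₂ p) ≟ e) f

  sumFin : (m : ℕ) → (Fin m → Carrier) → Carrier
  sumFin zero    g = 0#
  sumFin (suc m) g = g Fin.zero + sumFin m (λ i → g (Fin.suc i))

  -- The algebra A'_d : entries x[i,j,k], 1 ≤ i,j ≤ d+1, 1 ≤ k ≤ d,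
  -- stored 0-based: paper entry (i,j,k) ↔ (i-1, j-1, k-1).
  A' : ℕ → Set c
  A' d = Fin (suc d) → Fin (suc d) → Fin d → Carrier

  -- z[i,j,k] = Σ_l x[i,l,k+1] y[l,j,k+1] for k ≤ d-1, and z[i,j,d] = 0
  _∘A_ : ∀ {d} → A' d → A' d → A' d
  _∘A_ {d} x y i j k with nextFin k
  ... | just k' = sumFin (suc d) (λ l → x i l k' * y l j k')
  ... | nothing = 0#

  zeroA : ∀ {d} → A' d
  zeroA _ _ _ = 0#

  _+A_ : ∀ {d} → A' d → A' d → A' d
  (x +A y) i j k = x i j k + y i j k

  _·A_ : ∀ {d} → Carrier → A' d → A' d
  (a ·A x) i j k = a * x i j k

  -- The variables z_{i,j,k} are given by z i j k (j, k 1-based, as in the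
  -- paper; only j,k ∈ [d] are ever used).
  -- Z_i has (j, j+1, k)-th entry z_{i,j,k} (1-based), other entries 0.
  Zmat : ∀ {n} d → (Fin n → ℕ → ℕ → Carrier) → Fin n → A' d
  Zmat d z i a b k with toℕ b ≟ suc (toℕ a)
  ... | yes _ = z i (suc (toℕ a)) (suc (toℕ k))
  ... | no  _ = 0#

  evalT : ∀ {n} d → (Fin n → ℕ → ℕ → Carrier) → Tree n → A' d
  evalT d z (leaf i)   = Zmat d z i
  evalT d z (node a b) = evalT d z a ∘A evalT d z b

  ΦM : ∀ {n} d → (Fin n → ℕ → ℕ → Carrier) → Mon n → A' d
  ΦM d z 𝟙      = zeroA
  ΦM d z (tm t) = evalT d z t

  Φ : ∀ {n} d → (Fin n → ℕ → ℕ → Carrier) → Poly n → A' d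
  Φ d z []             = zeroA
  Φ d z ((a , m) ∷ f) = (a ·A ΦM d z m) +A Φ d z f

  -- φ(m) = Π_t z_{σ_m(t), t, l^m_t}
  prodLeaves : ∀ {n} → (Fin n → ℕ → ℕ → Carrier) → ℕ → List (Fin n × ℕ) → Carrier
  prodLeaves z t []             = 1#
  prodLeaves z t ((i , l) ∷ r) = z i t l * prodLeaves z (suc t) r

  φM : ∀ {n} → (Fin n → ℕ → ℕ → Carrier) → Mon n → Carrier
  φM z 𝟙      = 1#
  φM z (tm t) = prodLeaves z 1 (leavesL t 1)

  φ : ∀ {n} → (Fin n → ℕ → ℕ → Carrier) → Poly n → Carrier
  φ z []             = 0#
  φ z ((a , m) ∷ f) = a * φM z m + φ z f

{-# OPTIONS --safe #-}
module Submission where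

open import Defs
open import Level using (Level)
open import Algebra.Bundles using (CommutativeRing)
open import Data.Nat using (ℕ; zero; suc; _≤_; _<_; s≤s; z≤n; _≟_) renaming (_+_ to _+ℕ_)
import Data.Nat.Properties as ℕₚ
open ℕₚ using (≤-trans; <-trans; ≤-reflexive; m≤m+n; m<m+n)
open import Data.Fin using (Fin; fromℕ<; toℕ)
open import Data.Fin.Properties using (toℕ-fromℕ<; toℕ-injective; toℕ<n)
open import Data.Maybe using (just; nothing)
import Data.Maybe as Maybe
open import Data.List using (List; []; _∷_; _++_; length)
open import Data.List.Properties using (length-++; filter-all)
open import Data.List.Relation.Unary.All using ([]; _∷_)
open import Data.Product using (_×_; _,_; proj₂)
open import Relation.Nullary using (yes; no; contradiction)
open import Relation.Binary.PropositionalEquality as ≡ using (_≡_; _≢_; cong; cong₂; subst)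

-- Evaluating a tree t at the Z_i, the entry (a, b, k) (0-based) vanishes unless
-- b = a + deg t, since each Z_i is supported on the superdiagonal.  On that band
-- the sum over the middle index l of a product A ∘ B has the single nonzero term
-- l = a + deg A, and every product moves one level down; as long as
-- k + deg t ≤ d the last level, where ∘ is zero, is never reached.  By induction
-- the entry is then the product of z_{σ(s), a+s, k+l_s} over the leaves s.

nextFin-fromℕ< : ∀ {d} (k : Fin d) (k+1<d : suc (toℕ k) < d) →
  nextFin k ≡ just (fromℕ< k+1<d)
nextFin-fromℕ< {suc zero}    Fin.zero    (s≤s ())
nextFin-fromℕ< {suc (suc d)} Fin.zero    _       = ≡.refl
nextFin-fromℕ< {suc (suc d)} (Fin.suc k) (s≤s p) = cong (Maybe.map Fin.suc) (nextFin-fromℕ< k p)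

m+n<m+[n+o] : ∀ m n {o} → 1 ≤ o → m +ℕ n < m +ℕ (n +ℕ o)
m+n<m+[n+o] m n {o} o>0 = ≤-trans (m<m+n (m +ℕ n) o>0) (≤-reflexive (ℕₚ.+-assoc m n o))

1≤degT : ∀ {n} (t : Tree n) → 1 ≤ degT t
1≤degT (leaf _)   = s≤s z≤n
1≤degT (node a b) = ≤-trans (1≤degT a) (m≤m+n (degT a) (degT b))

length-leavesL : ∀ {n} (t : Tree n) l → length (leavesL t l) ≡ degT t
length-leavesL (leaf _)   l = ≡.refl
length-leavesL (node a b) l = ≡.trans (length-++ (leavesL a (suc l)))
  (cong₂ _+ℕ_ (length-leavesL a (suc l)) (length-leavesL b (suc l)))

fits-left : ∀ {n k d} (A B : Tree n) → k +ℕ degT (node A B) ≤ d → suc k +ℕ degT A ≤ d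
fits-left {k = k} A B fits = ≤-trans (m+n<m+[n+o] k (degT A) (1≤degT B)) fits

fits-right : ∀ {n k d} (A B : Tree n) → k +ℕ degT (node A B) ≤ d → suc k +ℕ degT B ≤ d
fits-right {k = k} {d} A B fits =
  ≤-trans (m+n<m+[n+o] k (degT B) (1≤degT A)) (subst (λ e → k +ℕ e ≤ d) (ℕₚ.+-comm (degT A) (degT B)) fits)

module _ {c ℓ : Level} (R : CommutativeRing c ℓ) where
  open CommutativeRing R
  open WithRing R
  open import Relation.Binary.Reasoning.Setoid setoid

  sumFin-≈0 : ∀ m (g : Fin m → Carrier) → (∀ i → g i ≈ 0#) → sumFin m g ≈ 0#
  sumFin-≈0 zero    g g≈0 = refl
  sumFin-≈0 (suc m) g g≈0 =
    trans (+-cong (g≈0 Fin.zero) (sumFin-≈0 m _ (λ i → g≈0 (Fin.suc i)))) (+-identityʳ 0#)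

  sumFin-single : ∀ m (g : Fin m → Carrier) (p : Fin m) →
    (∀ i → i ≢ p → g i ≈ 0#) → sumFin m g ≈ g p
  sumFin-single (suc m) g Fin.zero g≈0 =
    trans (+-congˡ (sumFin-≈0 m _ (λ i → g≈0 (Fin.suc i) λ ()))) (+-identityʳ _)
  sumFin-single (suc m) g (Fin.suc p) g≈0 =
    trans (+-cong (g≈0 Fin.zero λ ())
                  (sumFin-single m _ p λ i i≢p → g≈0 (Fin.suc i) λ { ≡.refl → i≢p ≡.refl }))
          (+-identityˡ _)

  module _ {n : ℕ} (z : Fin n → ℕ → ℕ → Carrier) where

    prodLeaves-++ : ∀ t (xs ys : List (Fin n × ℕ)) →
      prodLeaves z t (xs ++ ys) ≈ prodLeaves z t xs * prodLeaves z (t +ℕ length xs) ys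
    prodLeaves-++ t [] ys = begin
      prodLeaves z t ys               ≡⟨ cong (λ s → prodLeaves z s ys) (ℕₚ.+-identityʳ t) ⟨
      prodLeaves z (t +ℕ 0) ys        ≈⟨ *-identityˡ _ ⟨
      1# * prodLeaves z (t +ℕ 0) ys   ∎
    prodLeaves-++ t ((i , l) ∷ xs) ys = begin
      z i t l * prodLeaves z (suc t) (xs ++ ys)
        ≈⟨ *-congˡ (prodLeaves-++ (suc t) xs ys) ⟩
      z i t l * (prodLeaves z (suc t) xs * prodLeaves z (suc t +ℕ length xs) ys)
        ≈⟨ *-assoc _ _ _ ⟨
      z i t l * prodLeaves z (suc t) xs * prodLeaves z (suc t +ℕ length xs) ys
        ≡⟨ cong (λ s → z i t l * prodLeaves z (suc t) xs * prodLeaves z s ys) (ℕₚ.+-suc t (length xs)) ⟨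
      z i t l * prodLeaves z (suc t) xs * prodLeaves z (t +ℕ suc (length xs)) ys ∎

    prodLeaves-leavesL-node : ∀ s lev (A B : Tree n) →
      prodLeaves z s (leavesL (node A B) lev)
        ≈ prodLeaves z s (leavesL A (suc lev)) * prodLeaves z (s +ℕ degT A) (leavesL B (suc lev))
    prodLeaves-leavesL-node s lev A B = trans (prodLeaves-++ s (leavesL A (suc lev)) (leavesL B (suc lev)))
      (reflexive (cong (λ e → prodLeaves z s (leavesL A (suc lev)) * prodLeaves z (s +ℕ e) (leavesL B (suc lev)))
                       (length-leavesL A (suc lev))))

    evalT-node : ∀ {d} (A B : Tree n) (a b : Fin (suc d)) {k k′ : Fin d} → nextFin k ≡ just k′ →
      evalT d z (node A B) a b k ≡ sumFin (suc d) (λ l → evalT d z A a l k′ * evalT d z B l b k′)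
    evalT-node A B a b next≡ rewrite next≡ = ≡.refl

    evalT-vanishes : ∀ {d} (t : Tree n) (a b : Fin (suc d)) (k : Fin d) →
      toℕ b ≢ toℕ a +ℕ degT t → evalT d z t a b k ≈ 0#
    evalT-vanishes (leaf i) a b k b≢ with toℕ b ≟ suc (toℕ a)
    ... | yes b≡ = contradiction (≡.trans b≡ (ℕₚ.+-comm 1 (toℕ a))) b≢
    ... | no  _  = refl
    evalT-vanishes {d} (node A B) a b k b≢ with nextFin k
    ... | nothing = refl
    ... | just k′ = sumFin-≈0 (suc d) _ term≈0
      where
      term≈0 : ∀ l → evalT d z A a l k′ * evalT d z B l b k′ ≈ 0#
      term≈0 l with toℕ l ≟ toℕ a +ℕ degT A
      ... | no  l≢ = trans (*-congʳ (evalT-vanishes A a l k′ l≢)) (zeroˡ _)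
      ... | yes l≡ = trans (*-congˡ (evalT-vanishes B l b k′ λ b≡ →
        b≢ (≡.trans b≡ (≡.trans (cong (_+ℕ degT B) l≡) (ℕₚ.+-assoc (toℕ a) (degT A) (degT B))))))
        (zeroʳ _)

    evalT≈prodLeaves : ∀ {d} (t : Tree n) (a b : Fin (suc d)) (k : Fin d) →
      toℕ b ≡ toℕ a +ℕ degT t → toℕ k +ℕ degT t ≤ d →
      evalT d z t a b k ≈ prodLeaves z (suc (toℕ a)) (leavesL t (suc (toℕ k)))
    evalT≈prodLeaves (leaf i) a b k b≡ _ with toℕ b ≟ suc (toℕ a)
    ... | yes _  = sym (*-identityʳ _)
    ... | no  b≢ = contradiction (≡.trans b≡ (ℕₚ.+-comm (toℕ a) 1)) b≢
    evalT≈prodLeaves {d} (node A B) a b k b≡ fits = begin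
      evalT d z (node A B) a b k
        ≡⟨ evalT-node A B a b (nextFin-fromℕ< k k+1<d) ⟩
      sumFin (suc d) term
        ≈⟨ sumFin-single (suc d) term l₀ off-band ⟩
      evalT d z A a l₀ k′ * evalT d z B l₀ b k′
        ≈⟨ *-cong (evalT≈prodLeaves A a l₀ k′ toℕ-l₀ fitsA)
                  (evalT≈prodLeaves B l₀ b k′ b≡l₀+degB fitsB) ⟩
      prodLeaves z (suc (toℕ a)) (leavesL A (suc (toℕ k′))) * prodLeaves z (suc (toℕ l₀)) (leavesL B (suc (toℕ k′)))
        ≡⟨ cong₂ (λ lev s → prodLeaves z (suc (toℕ a)) (leavesL A lev) * prodLeaves z s (leavesL B lev))
                 (cong suc toℕ-k′) (cong suc toℕ-l₀) ⟩
      prodLeaves z (suc (toℕ a)) (leavesL A (suc (suc K))) * prodLeaves z (suc (toℕ a) +ℕ dA) (leavesL B (suc (suc K)))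
        ≈⟨ prodLeaves-leavesL-node (suc (toℕ a)) (suc K) A B ⟨
      prodLeaves z (suc (toℕ a)) (leavesL (node A B) (suc K)) ∎
      where
      K dA dB : ℕ
      K = toℕ k
      dA = degT A
      dB = degT B

      k+1<d : suc K < d
      k+1<d = ≤-trans (m<m+n (suc K) (1≤degT A)) (fits-left A B fits)
      k′ : Fin d
      k′ = fromℕ< k+1<d
      toℕ-k′ : toℕ k′ ≡ suc K
      toℕ-k′ = toℕ-fromℕ< k+1<d
      fitsA : toℕ k′ +ℕ dA ≤ d
      fitsA = subst (λ e → e +ℕ dA ≤ d) (≡.sym toℕ-k′) (fits-left A B fits)
      fitsB : toℕ k′ +ℕ dB ≤ d
      fitsB = subst (λ e → e +ℕ dB ≤ d) (≡.sym toℕ-k′) (fits-right A B fits)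

      a+dA<b : toℕ a +ℕ dA < toℕ b
      a+dA<b = subst (toℕ a +ℕ dA <_) (≡.sym b≡) (m+n<m+[n+o] (toℕ a) dA (1≤degT B))
      l₀ : Fin (suc d)
      l₀ = fromℕ< (<-trans a+dA<b (toℕ<n b))
      toℕ-l₀ : toℕ l₀ ≡ toℕ a +ℕ dA
      toℕ-l₀ = toℕ-fromℕ< _
      b≡l₀+degB : toℕ b ≡ toℕ l₀ +ℕ dB
      b≡l₀+degB = ≡.trans b≡ (≡.trans (≡.sym (ℕₚ.+-assoc (toℕ a) dA dB)) (cong (_+ℕ dB) (≡.sym toℕ-l₀)))

      term : Fin (suc d) → Carrier
      term l = evalT d z A a l k′ * evalT d z B l b k′
      off-band : ∀ l → l ≢ l₀ → term l ≈ 0#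
      off-band l l≢l₀ = trans (*-congʳ (evalT-vanishes A a l k′ λ l≡ →
        l≢l₀ (toℕ-injective (≡.trans l≡ (≡.sym toℕ-l₀))))) (zeroˡ _)

    Φ≈φ : ∀ {d d'} (f : Poly n) (b : Fin (suc (suc d))) → 1 ≤ d' → toℕ b ≡ d' → d' ≤ suc d →
      Homogeneous d' f → Φ (suc d) z f Fin.zero b Fin.zero ≈ φ z f
    Φ≈φ []               _ _    _  _   []            = refl
    Φ≈φ ((_ , 𝟙) ∷ _)    _ ()   _  _   (≡.refl ∷ _)
    Φ≈φ ((_ , tm t) ∷ f) b d'≥1 b≡ d'≤ (deg≡ ∷ hom) =
      +-cong (*-congˡ (evalT≈prodLeaves t Fin.zero b Fin.zero (≡.trans b≡ (≡.sym deg≡))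
                                        (≤-trans (≤-reflexive deg≡) d'≤)))
             (Φ≈φ f b d'≥1 b≡ d'≤ hom)

    component-homogeneous : ∀ {d'} (f : Poly n) → Homogeneous d' f → component d' f ≡ f
    component-homogeneous {d'} f = filter-all (λ p → deg (proj₂ p) ≟ d')

mainTheorem12 : ∀ {c ℓ : Level} (R : CommutativeRing c ℓ)
    → let open CommutativeRing R
          open WithRing R
      in (n d : ℕ) (hd : 1 ≤ d)
         (z : Fin n → ℕ → ℕ → Carrier)
         (d' : ℕ) (f : Poly n)
         (h1 : 1 ≤ d') (h2 : d' ≤ d)
      → Homogeneous d' f
      → Φ d z f (fromℕ< {0} (s≤s z≤n)) (fromℕ< {d'} (s≤s h2)) (fromℕ< {0} hd)
          ≈ φ z (component d' f)
mainTheorem12 R n (suc d) (s≤s z≤n) z d' f h1 h2 hom =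
  trans (Φ≈φ R z f _ h1 (toℕ-fromℕ< (s≤s h2)) h2 hom)
        (reflexive (cong (WithRing.φ R z) (≡.sym (component-homogeneous R z f hom))))
  where open CommutativeRing R
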